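{- There is a constant $\alpha<1$ such that for every tree $T$ (over a ranked alphabet) with $|T|>1$, one phase of the algorithm described in the context, applied to $T$, produces a tree of size at most $\alpha|T|$.
   Context: A tree over a ranked alphabet is a finite rooted ordered tree in which a node labelled by a letter of rank $k$ has exactly $k$ children; constants have rank $0$, unary letters rank $1$; $|T|$ is the number of nodes. A chain is a sequence of nodes $v_1,\dots,v_k$ all labelled by unary letters with $v_{i+1}$ the child of $v_i$; a maximal chain cannot be extended; an $a$-maximal chain is a chain of $a$-labelled nodes that cannot be extended by $a$-labelled nodes. A phase consists of three steps applied in order: (1) chain compression: for every unary letter $a$ and every $\ell>1$, replace each $a$-maximal chain of $\ell$ nodes by a single node labelled by a fresh unary letter $a_\ell$; (2) unary pair compression: choose a partition $F^{up}\uplus F^{down}$ of the unary letters of the current tree such that the number of pairs (node $u$, its child $v$) with $u$ labelled in $F^{up}$ and $v$ labelled in $F^{down}$ is at least $(n_1-c)/4$, where $n_1$ is the number of unary-labelled nodes and $c$ the number of maximal chains of the current tree, and replace every such pair by a single node labelled by a fresh unary letter (depending on the pair of labels); (3) leaf compression: for every node labelled $f$ of rank $m\ge1$ having at least one child that is a constant-labelled leaf, remove all its constant-labelled leaf children and relabel the node by a fresh letter of rank $m$ minus the number of removed children (determined by $f$ and the positions and labels of the removed children). -}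

module Defs where

open import Data.Nat using (ℕ; zero; suc; _+_; _*_; _≤_; _<_)
open import Data.Nat.Properties using () renaming (_≟_ to _≟ℕ_)
open import Data.Bool using (Bool; true; false; if_then_else_; _∧_; not)
open import Data.Maybe using (Maybe; just; nothing)
open import Data.Product using (_×_; _,_; Σ)
open import Data.Sum using (_⊎_; inj₁; inj₂)
open import Data.Vec using (Vec; []; _∷_)
open import Relation.Binary.Definitions using (DecidableEquality)
open import Relation.Binary.PropositionalEquality using (_≡_; refl; sym; subst)
open import Relation.Nullary using (yes; no)

data Tree {A : Set} (rank : A → ℕ) : Set where
  node : (a : A) → Vec (Tree rank) (rank a) → Tree rank

module _ {A : Set} {rank : A → ℕ} where
  mutual
    size : Tree rank → ℕ
    size (node a ts) = suc (sizes ts)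

    sizes : ∀ {n} → Vec (Tree rank) n → ℕ
    sizes [] = 0
    sizes (t ∷ ts) = size t + sizes ts

  isUnary : A → Bool
  isUnary a with rank a ≟ℕ 1
  ... | yes _ = true
  ... | no _ = false

  mutual
    countNodes : (Maybe A → A → ℕ) → Maybe A → Tree rank → ℕ
    countNodes w par (node a ts) = w par a + countNodesV w a ts

    countNodesV : ∀ {n} → (Maybe A → A → ℕ) → A → Vec (Tree rank) n → ℕ
    countNodesV w a [] = 0
    countNodesV w a (t ∷ ts) = countNodes w (just a) t + countNodesV w a ts

  b2n : Bool → ℕ
  b2n true = 1
  b2n false = 0

  parentUnary : Maybe A → Bool
  parentUnary nothing = false
  parentUnary (just p) = isUnary p

  nUnaryNodes : Tree rank → ℕ
  nUnaryNodes = countNodes (λ _ a → b2n (isUnary a)) nothing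

  -- c : number of maximal chains = number of unary nodes whose parent is
  -- not a unary node (or which are the root)
  nMaxChains : Tree rank → ℕ
  nMaxChains = countNodes (λ par a → b2n (isUnary a ∧ not (parentUnary par))) nothing

  -- A partition F^up ⊎ F^down of the unary letters is given by
  -- up : A → Bool  (a ∈ F^up iff up a ≡ true; only values on unary letters matter).
  upDownPair : (A → Bool) → Maybe A → A → Bool
  upDownPair up nothing a = false
  upDownPair up (just p) a = isUnary p ∧ up p ∧ isUnary a ∧ not (up a)

  nUpDownPairs : (A → Bool) → Tree rank → ℕ
  nUpDownPairs up = countNodes (λ par a → b2n (upDownPair up par a)) nothing

  -- admissibility condition of step (2):  #pairs ≥ (n₁ - c)/4
  GoodPartition : (A → Bool) → Tree rank → Set
  GoodPartition up T = nUnaryNodes T ≤ 4 * nUpDownPairs up T + nMaxChains T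

-- Step (1): chain compression.  Fresh letters a_ℓ are inj₂ (a , ℓ).

module ChainCompression {A : Set} (rank : A → ℕ) (_≟_ : DecidableEquality A) where

  rank₁ : A ⊎ (A × ℕ) → ℕ
  rank₁ (inj₁ a) = rank a
  rank₁ (inj₂ _) = 1

  T₀ = Tree rank
  T₁ = Tree rank₁

  -- result of processing a subtree: either a finished tree, or an
  -- a-chain of k nodes (at the top, to be possibly extended upwards)
  -- sitting above an already processed tree
  data Res : Set where
    done : T₁ → Res
    run  : (a : A) → rank a ≡ 1 → ℕ → T₁ → Res

  finish : Res → T₁
  finish (done t) = t
  finish (run a p (suc zero) s) = node (inj₁ a) (subst (Vec T₁) (sym p) (s ∷ []))
  finish (run a p k s) = node (inj₂ (a , k)) (s ∷ [])

  unaryStep : (a : A) → rank a ≡ 1 → Res → Res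
  unaryStep a p (done s) = run a p 1 s
  unaryStep a p (run b q k s) with a ≟ b
  ... | yes _ = run a p (suc k) s
  ... | no _  = run a p 1 (finish (run b q k s))

  mutual
    cc : T₀ → Res
    cc (node a ts) = ccN a (rank a) refl ts

    ccN : (a : A) (n : ℕ) → rank a ≡ n → Vec T₀ n → Res
    ccN a (suc zero) p (t ∷ []) = unaryStep a p (cc t)
    ccN a n p ts = done (node (inj₁ a) (subst (Vec T₁) (sym p) (ccs ts)))

    ccs : ∀ {n} → Vec T₀ n → Vec T₁ n
    ccs [] = []
    ccs (t ∷ ts) = finish (cc t) ∷ ccs ts

  chainCompress : T₀ → T₁
  chainCompress t = finish (cc t)

-- Step (2): unary pair compression w.r.t. up : B → Bool.
-- Fresh letter for the pair (b , c) is inj₂ (b , c).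

module PairCompression {B : Set} (rank : B → ℕ) (up : B → Bool) where

  rank₂ : B ⊎ (B × B) → ℕ
  rank₂ (inj₁ b) = rank b
  rank₂ (inj₂ _) = 1

  T = Tree rank
  T₂ = Tree rank₂

  mutual
    pc : T → T₂
    pc (node b ts) = pcN b (rank b) refl ts

    pcN : (b : B) (n : ℕ) → rank b ≡ n → Vec T n → T₂
    pcN b (suc zero) p (node c us ∷ []) = pcU b p c (rank c) refl us
    pcN b n p ts = node (inj₁ b) (subst (Vec T₂) (sym p) (pcs ts))

    pcU : (b : B) → rank b ≡ 1 → (c : B) (m : ℕ) → rank c ≡ m → Vec T m → T₂
    pcU b p c (suc zero) q us@(w ∷ []) =
      if up b ∧ not (up c)
      then node (inj₂ (b , c)) (pc w ∷ [])
      else node (inj₁ b) (subst (Vec T₂) (sym p) (pcN c 1 q us ∷ []))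
    pcU b p c m q us = node (inj₁ b) (subst (Vec T₂) (sym p) (pcN c m q us ∷ []))

    pcs : ∀ {n} → Vec T n → Vec T₂ n
    pcs [] = []
    pcs (t ∷ ts) = pc t ∷ pcs ts

  pairCompress : T → T₂
  pairCompress = pc

-- A node f with at least one constant leaf
-- child gets the fresh letter inj₂ (f , v), where v : Vec (Maybe C) (rank f)
-- records, for every child position, the label of the removed constant
-- (just c) or that the child is kept (nothing).

module LeafCompression {C : Set} (rank : C → ℕ) where

  countNothing : ∀ {n} → Vec (Maybe C) n → ℕ
  countNothing [] = 0
  countNothing (nothing ∷ v) = suc (countNothing v)
  countNothing (just _ ∷ v) = countNothing v

  rank₃ : C ⊎ (Σ C (λ f → Vec (Maybe C) (rank f))) → ℕ
  rank₃ (inj₁ c) = rank c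
  rank₃ (inj₂ (f , v)) = countNothing v

  T = Tree rank
  T₃ = Tree rank₃

  isConst : T → Maybe C
  isConst (node c us) with rank c ≟ℕ 0
  ... | yes _ = just c
  ... | no _  = nothing

  marks : ∀ {n} → Vec T n → Vec (Maybe C) n
  marks [] = []
  marks (t ∷ ts) = isConst t ∷ marks ts

  anyJust : ∀ {n} → Vec (Maybe C) n → Bool
  anyJust [] = false
  anyJust (just _ ∷ v) = true
  anyJust (nothing ∷ v) = anyJust v

  mutual
    lc : T → T₃
    lc (node f ts) with anyJust (marks ts)
    ... | false = node (inj₁ f) (lcs ts)
    ... | true  = node (inj₂ (f , marks ts)) (keep ts)

    lcs : ∀ {n} → Vec T n → Vec T₃ n
    lcs [] = []
    lcs (t ∷ ts) = lc t ∷ lcs ts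

    keep : ∀ {n} → (ts : Vec T n) → Vec T₃ (countNothing (marks ts))
    keep [] = []
    keep (t ∷ ts) = keep₁ t (isConst t) refl ts

    keep₁ : ∀ {n} → (t : T) (m : Maybe C) → isConst t ≡ m → (ts : Vec T n) →
            Vec T₃ (countNothing (m ∷ marks ts))
    keep₁ t nothing _ ts = lc t ∷ keep ts
    keep₁ t (just _) _ ts = keep ts

  leafCompress : T → T₃
  leafCompress = lc

module _ {A : Set} (rank : A → ℕ) (_≟_ : DecidableEquality A) where
  open ChainCompression rank _≟_ using (rank₁; chainCompress)

  Letter₁ : Set
  Letter₁ = A ⊎ (A × ℕ)

  phase : (T : Tree rank) (up : Letter₁ → Bool) → Σ Set (λ D → Σ (D → ℕ) Tree)
  phase T up =
    let T₁ = chainCompress T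
        T₂ = PairCompression.pairCompress rank₁ up T₁
    in _ , _ , LeafCompression.leafCompress (PairCompression.rank₂ rank₁ up) T₂

  phaseSize : Tree rank → (Letter₁ → Bool) → ℕ
  phaseSize T up = size (Σ.proj₂ (Σ.proj₂ (phase T up)))

module Submission where

-- Let T₁ be the tree after chain compression, with L leaves, U unary nodes,
-- B branching nodes (rank ≥ 2), C maximal chains and P up/down pairs for the
-- chosen partition.  The proof combines six facts:
--   (a) chain compression does not enlarge the tree:      L + U + B ≤ |T|;
--   (b) a tree has more leaves than branching nodes:      B + 1 ≤ L;
--   (c) below each maximal chain hangs its own leaf or
--       branching node:                                   C ≤ L + B;
--   (d) pair compression merges the P pairs, so the tree T₂ it produces has
--       at most U + B − P inner (non-constant) nodes;
--   (e) leaf compression removes every leaf of T₂ (the root of T₂ is not a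
--       leaf because |T| > 1), so the output has at most as many nodes as
--       T₂ has inner nodes;
--   (f) the admissibility of the partition:               U ≤ 4P + C.
-- Linear arithmetic then gives 4 · |output| ≤ 3 · |T|.

open import Defs
open import Data.Nat using (ℕ; zero; suc; _+_; _*_; _≤_; _<_; z≤n; s≤s)
open import Data.Nat.Properties using (+-identityʳ; +-comm; n≮0; n≢0⇒n>0; +-mono-≤; +-monoˡ-≤; +-monoʳ-≤; *-monoʳ-≤; ≤-refl; ≤-trans; ≤-reflexive; m≤m+n; m≤n+m; n≤1+n; +-cancelʳ-≤; +-commutativeSemigroup; module ≤-Reasoning) renaming (_≟_ to _≟ℕ_)
open import Algebra.Properties.CommutativeSemigroup +-commutativeSemigroup using (interchange)
open import Data.Bool using (Bool; true; false; _∧_; not)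
open import Data.Bool.Properties using (∧-zeroʳ)
open import Data.Maybe using (Maybe; just; nothing)
open import Data.Product using (Σ; _×_; _,_)
open import Data.Sum using (inj₁)
open import Data.Vec using (Vec; []; _∷_)
open import Data.Empty using (⊥-elim)
open import Relation.Binary.Definitions using (DecidableEquality)
open import Relation.Binary.PropositionalEquality using (_≡_; _≢_; refl; sym; trans; cong; cong₂; subst; subst₂)
open import Relation.Nullary using (yes; no)
open import Data.Nat.Tactic.RingSolver using (solve-∀)

leafᵂ unaryᵂ branchᵂ innerᵂ nonunaryᵂ : ℕ → ℕ
leafᵂ zero = 1
leafᵂ (suc _) = 0
unaryᵂ (suc zero) = 1
unaryᵂ _ = 0
branchᵂ (suc (suc _)) = 1
branchᵂ _ = 0
innerᵂ zero = 0
innerᵂ (suc _) = 1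
nonunaryᵂ (suc zero) = 0
nonunaryᵂ _ = 1

one≡leaf+inner : ∀ n → 1 ≡ leafᵂ n + innerᵂ n
one≡leaf+inner zero = refl
one≡leaf+inner (suc n) = refl

inner≡unary+branch : ∀ n → innerᵂ n ≡ unaryᵂ n + branchᵂ n
inner≡unary+branch zero = refl
inner≡unary+branch (suc zero) = refl
inner≡unary+branch (suc (suc n)) = refl

nonunary≡leaf+branch : ∀ n → nonunaryᵂ n ≡ leafᵂ n + branchᵂ n
nonunary≡leaf+branch zero = refl
nonunary≡leaf+branch (suc zero) = refl
nonunary≡leaf+branch (suc (suc n)) = refl

-- Local form of "leaves outnumber branching nodes": a node of rank n
-- is a branching node only if it opens n ≥ 2 subtrees.
branch+1≤leaf+rank : ∀ n → branchᵂ n + 1 ≤ leafᵂ n + n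
branch+1≤leaf+rank zero = ≤-refl
branch+1≤leaf+rank (suc zero) = ≤-refl
branch+1≤leaf+rank (suc (suc n)) = s≤s (s≤s z≤n)

inner-of-positive : ∀ {n} → 0 < n → innerᵂ n ≡ 1
inner-of-positive (s≤s _) = refl

module _ {A : Set} {rank : A → ℕ} where

  rootRank : Tree rank → ℕ
  rootRank (node a _) = rank a

  mutual
    census : (ℕ → ℕ) → Tree rank → ℕ
    census w (node a ts) = w (rank a) + censusV w ts

    censusV : ∀ {n} → (ℕ → ℕ) → Vec (Tree rank) n → ℕ
    censusV w [] = 0
    censusV w (t ∷ ts) = census w t + censusV w ts

  mutual
    census-+ : ∀ {w u v} → (∀ n → w n ≡ u n + v n) →
               ∀ t → census w t ≡ census u t + census v t
    census-+ {w} {u} {v} split (node a ts) =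
      trans (cong₂ _+_ (split (rank a)) (censusV-+ split ts))
            (interchange (u (rank a)) (v (rank a)) (censusV u ts) (censusV v ts))

    censusV-+ : ∀ {w u v} → (∀ n → w n ≡ u n + v n) →
                ∀ {n} (ts : Vec (Tree rank) n) → censusV w ts ≡ censusV u ts + censusV v ts
    censusV-+ split [] = refl
    censusV-+ {w} {u} {v} split (t ∷ ts) =
      trans (cong₂ _+_ (census-+ split t) (censusV-+ split ts))
            (interchange (census u t) (census v t) (censusV u ts) (censusV v ts))

  mutual
    size≡census : ∀ t → size t ≡ census (λ _ → 1) t
    size≡census (node a ts) = cong suc (sizes≡censusV ts)

    sizes≡censusV : ∀ {n} (ts : Vec (Tree rank) n) → sizes ts ≡ censusV (λ _ → 1) ts
    sizes≡censusV [] = refl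
    sizes≡censusV (t ∷ ts) = cong₂ _+_ (size≡census t) (sizes≡censusV ts)

  size≡leaves+inner : ∀ t → size t ≡ census leafᵂ t + census innerᵂ t
  size≡leaves+inner t = trans (size≡census t) (census-+ one≡leaf+inner t)

  mutual
    branchings<leaves : ∀ t → census branchᵂ t + 1 ≤ census leafᵂ t
    branchings<leaves (node a ts) = begin
      branchᵂ r + censusV branchᵂ ts + 1   ≡⟨ shuffle (branchᵂ r) (censusV branchᵂ ts) ⟩
      (branchᵂ r + 1) + censusV branchᵂ ts ≤⟨ +-monoˡ-≤ (censusV branchᵂ ts) (branch+1≤leaf+rank r) ⟩
      (leafᵂ r + r) + censusV branchᵂ ts   ≡⟨ regroup (leafᵂ r) r (censusV branchᵂ ts) ⟩
      leafᵂ r + (censusV branchᵂ ts + r)   ≤⟨ +-monoʳ-≤ (leafᵂ r) (branchings+width≤leaves ts) ⟩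
      leafᵂ r + censusV leafᵂ ts           ∎
      where
      open ≤-Reasoning
      r : ℕ
      r = rank a
      shuffle : ∀ x y → x + y + 1 ≡ (x + 1) + y
      shuffle = solve-∀
      regroup : ∀ x y z → (x + y) + z ≡ x + (z + y)
      regroup = solve-∀

    branchings+width≤leaves : ∀ {n} (ts : Vec (Tree rank) n) → censusV branchᵂ ts + n ≤ censusV leafᵂ ts
    branchings+width≤leaves [] = z≤n
    branchings+width≤leaves {suc n} (t ∷ ts) =
      ≤-trans (≤-reflexive (regroup (census branchᵂ t) (censusV branchᵂ ts) n))
              (+-mono-≤ (branchings<leaves t) (branchings+width≤leaves ts))
      where
      regroup : ∀ x y n → (x + y) + suc n ≡ (x + 1) + (y + n)
      regroup = solve-∀

  mutual
    countNodes-census : ∀ {w u} → (∀ par a → w par a ≡ u (rank a)) →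
                        ∀ par t → countNodes w par t ≡ census u t
    countNodes-census same par (node a ts) = cong₂ _+_ (same par a) (countNodesV-census same a ts)

    countNodesV-census : ∀ {w u} → (∀ par a → w par a ≡ u (rank a)) →
                         ∀ a {n} (ts : Vec (Tree rank) n) → countNodesV w a ts ≡ censusV u ts
    countNodesV-census same a [] = refl
    countNodesV-census same a (t ∷ ts) =
      cong₂ _+_ (countNodes-census same (just a) t) (countNodesV-census same a ts)

  isUnary-true : ∀ {a} → rank a ≡ 1 → isUnary {rank = rank} a ≡ true
  isUnary-true {a} r≡1 with rank a ≟ℕ 1
  ... | yes _ = refl
  ... | no r≢1 = ⊥-elim (r≢1 r≡1)

  isUnary-false : ∀ {a n} → rank a ≡ n → n ≢ 1 → isUnary {rank = rank} a ≡ false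
  isUnary-false {a} r≡n n≢1 with rank a ≟ℕ 1
  ... | yes r≡1 = ⊥-elim (n≢1 (trans (sym r≡n) r≡1))
  ... | no _ = refl

  isUnary-weight : ∀ a → b2n {rank = rank} (isUnary {rank = rank} a) ≡ unaryᵂ (rank a)
  isUnary-weight a with rank a ≟ℕ 1
  ... | yes r≡1 rewrite r≡1 = refl
  ... | no r≢1 = unaryᵂ-other (rank a) r≢1
    where
    unaryᵂ-other : ∀ n → n ≢ 1 → 0 ≡ unaryᵂ n
    unaryᵂ-other zero _ = refl
    unaryᵂ-other (suc zero) n≢1 = ⊥-elim (n≢1 refl)
    unaryᵂ-other (suc (suc n)) _ = refl

  unaryNodes≡census : ∀ t → nUnaryNodes t ≡ census unaryᵂ t
  unaryNodes≡census = countNodes-census (λ _ → isUnary-weight) nothing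

  b2n≤1 : ∀ x → b2n {rank = rank} x ≤ 1
  b2n≤1 true = ≤-refl
  b2n≤1 false = z≤n

  chainTop : Maybe A → A → ℕ
  chainTop par a = b2n {rank = rank} (isUnary {rank = rank} a ∧ not (parentUnary {rank = rank} par))

  mutual
    -- Below a node (exclusive) there are fewer chain tops than non-unary
    -- nodes in its subtree (inclusive): each chain ends above its own
    -- non-unary node.
    chainTops<nonunary : ∀ a n → rank a ≡ n → (ts : Vec (Tree rank) n) →
                         countNodesV chainTop a ts + 1 ≤ nonunaryᵂ n + censusV nonunaryᵂ ts
    chainTops<nonunary a zero r≡n [] = ≤-refl
    chainTops<nonunary a (suc zero) r≡1 (node c us ∷ [])
      rewrite isUnary-true r≡1 | ∧-zeroʳ (isUnary {rank = rank} c) =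
      subst₂ _≤_ (cong (_+ 1) (sym (+-identityʳ _))) (sym (+-identityʳ _))
             (chainTops<nonunary c (rank c) refl us)
    chainTops<nonunary a (suc (suc n)) r≡n ts =
      ≤-trans (≤-reflexive (+-comm (countNodesV chainTop a ts) 1))
              (s≤s (chainTopsV≤nonunary a ts))

    chainTops≤nonunary : ∀ par t → countNodes chainTop par t ≤ census nonunaryᵂ t
    chainTops≤nonunary par (node a ts) =
      ≤-trans (+-monoˡ-≤ (countNodesV chainTop a ts) (b2n≤1 _))
              (≤-trans (≤-reflexive (+-comm 1 (countNodesV chainTop a ts)))
                       (chainTops<nonunary a (rank a) refl ts))

    chainTopsV≤nonunary : ∀ a {n} (ts : Vec (Tree rank) n) → countNodesV chainTop a ts ≤ censusV nonunaryᵂ ts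
    chainTopsV≤nonunary a [] = z≤n
    chainTopsV≤nonunary a (t ∷ ts) = +-mono-≤ (chainTops≤nonunary (just a) t) (chainTopsV≤nonunary a ts)

  maxChains≤leaves+branchings : ∀ t → nMaxChains t ≤ census leafᵂ t + census branchᵂ t
  maxChains≤leaves+branchings t =
    ≤-trans (chainTops≤nonunary nothing t) (≤-reflexive (census-+ nonunary≡leaf+branch t))

  big⇒inner-root : ∀ t → 1 < size t → 0 < rootRank t
  big⇒inner-root (node a ts) = positive-width ts
    where
    positive-width : ∀ {n} (ts : Vec (Tree rank) n) → 1 < suc (sizes ts) → 0 < n
    positive-width [] (s≤s ())
    positive-width (t ∷ ts) _ = s≤s z≤n

module _ {B : Set} {rank : B → ℕ} where

  size-relabel : ∀ f {n} (r≡n : rank f ≡ n) (vs : Vec (Tree rank) n) →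
                 size (node f (subst (Vec (Tree rank)) (sym r≡n) vs)) ≡ suc (sizes vs)
  size-relabel f refl vs = refl

  census-relabel : ∀ w f {n} (r≡n : rank f ≡ n) (vs : Vec (Tree rank) n) →
                   census w (node f (subst (Vec (Tree rank)) (sym r≡n) vs)) ≡ w n + censusV w vs
  census-relabel w f refl vs = refl

module ChainCompressionSize {A : Set} (rank : A → ℕ) (_≟_ : DecidableEquality A) where
  open ChainCompression rank _≟_

  -- The size a partial result will have once it is finished.
  pendingSize : Res → ℕ
  pendingSize (done t) = size t
  pendingSize (run _ _ _ s) = suc (size s)

  finish-size : ∀ r → size (finish r) ≡ pendingSize r
  finish-size (done t) = refl
  finish-size (run a r≡1 zero s) = cong suc (+-identityʳ (size s))
  finish-size (run a r≡1 (suc zero) s) = trans (size-relabel (inj₁ a) r≡1 (s ∷ [])) (cong suc (+-identityʳ (size s)))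
  finish-size (run a r≡1 (suc (suc k)) s) = cong suc (+-identityʳ (size s))

  unaryStep-size : ∀ a r≡1 r → pendingSize (unaryStep a r≡1 r) ≤ suc (pendingSize r)
  unaryStep-size a r≡1 (done s) = ≤-refl
  unaryStep-size a r≡1 (run b q k s) with a ≟ b
  ... | yes _ = n≤1+n _
  ... | no _ = s≤s (≤-reflexive (finish-size (run b q k s)))

  mutual
    -- A maximal chain of ℓ nodes becomes at most ℓ nodes.
    cc-size : ∀ t → pendingSize (cc t) ≤ size t
    cc-size (node a ts) = ccN-size a (rank a) refl ts

    ccN-size : ∀ a n (r≡n : rank a ≡ n) ts → pendingSize (ccN a n r≡n ts) ≤ suc (sizes ts)
    ccN-size a zero r≡0 [] = ≤-reflexive (size-relabel {rank = rank₁} (inj₁ a) r≡0 [])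
    ccN-size a (suc zero) r≡1 (t ∷ []) =
      ≤-trans (unaryStep-size a r≡1 (cc t)) (s≤s (≤-trans (cc-size t) (m≤m+n (size t) 0)))
    ccN-size a (suc (suc n)) r≡n ts =
      ≤-trans (≤-reflexive (size-relabel (inj₁ a) r≡n (ccs ts))) (s≤s (ccs-size ts))

    ccs-size : ∀ {n} (ts : Vec T₀ n) → sizes (ccs ts) ≤ sizes ts
    ccs-size [] = z≤n
    ccs-size (t ∷ ts) = +-mono-≤ (≤-trans (≤-reflexive (finish-size (cc t))) (cc-size t)) (ccs-size ts)

  chainCompress-size : ∀ t → size (chainCompress t) ≤ size t
  chainCompress-size t = ≤-trans (≤-reflexive (finish-size (cc t))) (cc-size t)

  finish-run-rootRank : ∀ a r≡1 k s → rootRank (finish (run a r≡1 k s)) ≡ 1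
  finish-run-rootRank a r≡1 zero s = refl
  finish-run-rootRank a r≡1 (suc zero) s = r≡1
  finish-run-rootRank a r≡1 (suc (suc k)) s = refl

  unaryStep-rootRank : ∀ a r≡1 r → rootRank (finish (unaryStep a r≡1 r)) ≡ 1
  unaryStep-rootRank a r≡1 (done s) = r≡1
  unaryStep-rootRank a r≡1 (run b q k s) with a ≟ b
  ... | yes _ = finish-run-rootRank a r≡1 (suc k) s
  ... | no _ = r≡1

  -- Chain compression only relabels unary nodes by unary letters.
  ccN-rootRank : ∀ a n (r≡n : rank a ≡ n) ts → rootRank (finish (ccN a n r≡n ts)) ≡ n
  ccN-rootRank a zero r≡0 [] = r≡0
  ccN-rootRank a (suc zero) r≡1 (t ∷ []) = unaryStep-rootRank a r≡1 (cc t)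
  ccN-rootRank a (suc (suc n)) r≡n ts = r≡n

  chainCompress-rootRank : ∀ t → rootRank (chainCompress t) ≡ rootRank t
  chainCompress-rootRank (node a ts) = ccN-rootRank a (rank a) refl ts

module PairCompressionSize {B : Set} (rank : B → ℕ) (up : B → Bool) where
  open PairCompression rank up

  pairBottom : Maybe B → B → ℕ
  pairBottom par a = b2n {rank = rank} (upDownPair {rank = rank} up par a)

  pair-nonunaryParent : ∀ {b c} → isUnary {rank = rank} b ≡ false → upDownPair {rank = rank} up (just b) c ≡ false
  pair-nonunaryParent e rewrite e = refl

  pair-downParent : ∀ {b c} → up b ≡ false → upDownPair {rank = rank} up (just b) c ≡ false
  pair-downParent {b} e with isUnary {rank = rank} b
  ... | false = refl
  ... | true rewrite e = refl

  pair-nonunaryChild : ∀ {b c} → isUnary {rank = rank} c ≡ false → upDownPair {rank = rank} up (just b) c ≡ false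
  pair-nonunaryChild {b} e with isUnary {rank = rank} b | up b
  ... | false | _ = refl
  ... | true | false = refl
  ... | true | true rewrite e = refl

  pair-unary : ∀ {b c} → isUnary {rank = rank} b ≡ true → isUnary {rank = rank} c ≡ true →
               upDownPair {rank = rank} up (just b) c ≡ (up b ∧ not (up c))
  pair-unary eb ec rewrite eb | ec = refl

  down-of-pair : ∀ x y → x ∧ not y ≡ true → y ≡ false
  down-of-pair true false _ = refl

  pairs-detached : ∀ par a (us : Vec T (rank a)) → upDownPair {rank = rank} up par a ≡ false →
                   countNodes pairBottom par (node a us) ≡ nUpDownPairs up (node a us)
  pairs-detached par a us e = cong (λ x → b2n {rank = rank} x + countNodesV pairBottom a us) e

  pcU-unpaired : ∀ b (r≡1 : rank b ≡ 1) c m (q : rank c ≡ m) (us : Vec T m) →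
                 upDownPair {rank = rank} up (just b) c ≡ false →
                 census innerᵂ (pcN c m q us) + countNodesV pairBottom c us ≤ innerᵂ m + censusV innerᵂ us →
                 census innerᵂ (node (inj₁ b) (subst (Vec T₂) (sym r≡1) (pcN c m q us ∷ [])))
                   + (pairBottom (just b) c + countNodesV pairBottom c us)
                   ≤ suc (innerᵂ m + censusV innerᵂ us)
  pcU-unpaired b r≡1 c m q us e child
    rewrite census-relabel innerᵂ (inj₁ b) r≡1 (pcN c m q us ∷ []) | e =
    subst₂ _≤_ (wrap (census innerᵂ (pcN c m q us)) (countNodesV pairBottom c us)) refl (s≤s child)
    where
    wrap : ∀ x y → suc (x + y) ≡ (1 + (x + 0)) + (0 + y)
    wrap = solve-∀

  -- A unary node b above a unary node c above d: either (b, c) is a pair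
  -- and is merged into one node, or c is compressed on its own.
  pcU-unary : ∀ b (r≡1 : rank b ≡ 1) c (q : rank c ≡ 1) d (vs : Vec T (rank d)) →
              census innerᵂ (pc (node d vs)) + nUpDownPairs up (node d vs) ≤ census innerᵂ (node d vs) →
              census innerᵂ (pcN c 1 q (node d vs ∷ [])) + countNodesV pairBottom c (node d vs ∷ [])
                ≤ 1 + censusV innerᵂ (node d vs ∷ []) →
              census innerᵂ (pcU b r≡1 c 1 q (node d vs ∷ []))
                + (pairBottom (just b) c + countNodesV pairBottom c (node d vs ∷ []))
                ≤ suc (1 + censusV innerᵂ (node d vs ∷ []))
  pcU-unary b r≡1 c q d vs grandchild child with up b ∧ not (up c) in e
  ... | true =
    subst₂ _≤_ (cong₂ (λ x y → suc (census innerᵂ (pc (node d vs)) + 0) + (b2n {rank = rank} x + (y + 0)))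
                      (sym (trans (pair-unary (isUnary-true r≡1) (isUnary-true q)) e))
                      (sym (pairs-detached (just c) d vs (pair-downParent (down-of-pair (up b) (up c) e)))))
               refl
               (merged grandchild)
    where
    merged : ∀ {x y z} → x + y ≤ z → suc (x + 0) + (1 + (y + 0)) ≤ suc (1 + (z + 0))
    merged {x} {y} {z} h = subst₂ _≤_ (lhs x y) (rhs z) (s≤s (s≤s h))
      where
      lhs : ∀ x y → suc (suc (x + y)) ≡ suc (x + 0) + (1 + (y + 0))
      lhs = solve-∀
      rhs : ∀ z → suc (suc z) ≡ suc (1 + (z + 0))
      rhs = solve-∀
  ... | false =
    pcU-unpaired b r≡1 c 1 q (node d vs ∷ []) (trans (pair-unary (isUnary-true r≡1) (isUnary-true q)) e) child

  mutual
    -- Every pair removes one inner node.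
    pc-inner : ∀ t → census innerᵂ (pc t) + nUpDownPairs up t ≤ census innerᵂ t
    pc-inner (node b ts) = pcN-inner b (rank b) refl ts

    pcN-inner : ∀ b n (r≡n : rank b ≡ n) (ts : Vec T n) →
                census innerᵂ (pcN b n r≡n ts) + countNodesV pairBottom b ts ≤ innerᵂ n + censusV innerᵂ ts
    pcN-inner b zero r≡0 [] = ≤-reflexive (trans (+-identityʳ _) (census-relabel {rank = rank₂} innerᵂ (inj₁ b) r≡0 []))
    pcN-inner b (suc zero) r≡1 (node c us ∷ []) =
      subst₂ _≤_ (cong (census innerᵂ (pcU b r≡1 c (rank c) refl us) +_) (sym (+-identityʳ _)))
                 (cong suc (sym (+-identityʳ _)))
             (pcU-inner b r≡1 c (rank c) refl us)
    pcN-inner b (suc (suc n)) r≡n ts =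
      ≤-trans (≤-reflexive (cong (_+ countNodesV pairBottom b ts) (census-relabel innerᵂ (inj₁ b) r≡n (pcs ts))))
              (s≤s (pcs-inner b (isUnary-false r≡n λ ()) ts))

    pcU-inner : ∀ b (r≡1 : rank b ≡ 1) c m (q : rank c ≡ m) (us : Vec T m) →
                census innerᵂ (pcU b r≡1 c m q us) + (pairBottom (just b) c + countNodesV pairBottom c us)
                  ≤ suc (innerᵂ m + censusV innerᵂ us)
    pcU-inner b r≡1 c zero q [] =
      pcU-unpaired b r≡1 c zero q [] (pair-nonunaryChild (isUnary-false q λ ())) (pcN-inner c zero q [])
    pcU-inner b r≡1 c (suc (suc m)) q us =
      pcU-unpaired b r≡1 c (suc (suc m)) q us (pair-nonunaryChild (isUnary-false q λ ())) (pcN-inner c (suc (suc m)) q us)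
    pcU-inner b r≡1 c (suc zero) q (node d vs ∷ []) =
      pcU-unary b r≡1 c q d vs (pc-inner (node d vs)) (pcN-inner c 1 q (node d vs ∷ []))

    -- No pair starts at a non-unary node, so its children are compressed
    -- independently.
    pcs-inner : ∀ b → isUnary {rank = rank} b ≡ false → ∀ {n} (ts : Vec T n) →
                censusV innerᵂ (pcs ts) + countNodesV pairBottom b ts ≤ censusV innerᵂ ts
    pcs-inner b e [] = z≤n
    pcs-inner b e (node a us ∷ ts) =
      ≤-trans (≤-reflexive (trans (interchange (census innerᵂ (pc (node a us))) (censusV innerᵂ (pcs ts)) _ _)
                                  (cong (λ x → (census innerᵂ (pc (node a us)) + x) + _)
                                        (pairs-detached (just b) a us (pair-nonunaryParent e)))))
              (+-mono-≤ (pc-inner (node a us)) (pcs-inner b e ts))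

  mutual
    pc-rootRank : ∀ t → rootRank (pc t) ≡ rootRank t
    pc-rootRank (node b ts) = pcN-rootRank b (rank b) refl ts

    pcN-rootRank : ∀ b n (r≡n : rank b ≡ n) (ts : Vec T n) → rootRank (pcN b n r≡n ts) ≡ n
    pcN-rootRank b zero r≡0 [] = r≡0
    pcN-rootRank b (suc zero) r≡1 (node c us ∷ []) = pcU-rootRank b r≡1 c (rank c) refl us
    pcN-rootRank b (suc (suc n)) r≡n ts = r≡n

    pcU-rootRank : ∀ b (r≡1 : rank b ≡ 1) c m (q : rank c ≡ m) (us : Vec T m) → rootRank (pcU b r≡1 c m q us) ≡ 1
    pcU-rootRank b r≡1 c zero q us = r≡1
    pcU-rootRank b r≡1 c (suc (suc m)) q us = r≡1
    pcU-rootRank b r≡1 c (suc zero) q (w ∷ []) with up b ∧ not (up c)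
    ... | true = refl
    ... | false = r≡1

module LeafCompressionSize {C : Set} (rank : C → ℕ) where
  open LeafCompression rank

  inner-root⇒nonconstant : ∀ t → 0 < rootRank t → isConst t ≡ nothing
  inner-root⇒nonconstant (node f ts) 0<r with rank f ≟ℕ 0
  ... | yes r≡0 = ⊥-elim (n≮0 (subst (0 <_) r≡0 0<r))
  ... | no _ = refl

  nonconstant⇒inner : ∀ f (ts : Vec T (rank f)) → isConst (node f ts) ≡ nothing → innerᵂ (rank f) ≡ 1
  nonconstant⇒inner f ts e with rank f ≟ℕ 0
  nonconstant⇒inner f ts () | yes _
  ... | no r≢0 = inner-of-positive (n≢0⇒n>0 r≢0)

  mutual
    -- Leaf compression keeps a node only if it is not a constant leaf
    -- child; the root itself contributes one node.
    lc-node : ∀ f (ts : Vec T (rank f)) → size (lc (node f ts)) ≤ suc (censusV innerᵂ ts)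
    lc-node f ts with anyJust (marks ts) in noConstChild
    ... | false = s≤s (lcs-size ts noConstChild)
    ... | true = s≤s (keep-size ts)

    lc-size : ∀ t → isConst t ≡ nothing → size (lc t) ≤ census innerᵂ t
    lc-size (node f ts) e =
      ≤-trans (lc-node f ts) (≤-reflexive (cong (_+ censusV innerᵂ ts) (sym (nonconstant⇒inner f ts e))))

    lcs-size : ∀ {n} (ts : Vec T n) → anyJust (marks ts) ≡ false → sizes (lcs ts) ≤ censusV innerᵂ ts
    lcs-size [] _ = z≤n
    lcs-size (t ∷ ts) noConstChild with isConst t in e
    ... | nothing = +-mono-≤ (lc-size t e) (lcs-size ts noConstChild)
    lcs-size (t ∷ ts) () | just _

    keep-size : ∀ {n} (ts : Vec T n) → sizes (keep ts) ≤ censusV innerᵂ ts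
    keep-size [] = z≤n
    keep-size (t ∷ ts) = keep₁-size t (isConst t) refl ts

    keep₁-size : ∀ {n} t m (e : isConst t ≡ m) (ts : Vec T n) → sizes (keep₁ t m e ts) ≤ census innerᵂ t + censusV innerᵂ ts
    keep₁-size t nothing e ts = +-mono-≤ (lc-size t e) (keep-size ts)
    keep₁-size t (just _) e ts = ≤-trans (keep-size ts) (m≤n+m _ _)

  leafCompress-size : ∀ t → 0 < rootRank t → size (leafCompress t) ≤ census innerᵂ t
  leafCompress-size t 0<r = lc-size t (inner-root⇒nonconstant t 0<r)

-- Fact (f) and facts (a)–(e) combine by linear arithmetic:
-- out ≤ U + B − P ≤ U + B − (U − L − B)/4 = (3U + 5B + L)/4 ≤ 3(L + U + B)/4.
phase-arithmetic : ∀ {out I P U B C L S} → out ≤ I → I + P ≤ U + B → U ≤ 4 * P + C →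
                   C ≤ L + B → B + 1 ≤ L → L + (U + B) ≤ S → 4 * out ≤ 3 * S
phase-arithmetic {out} {I} {P} {U} {B} {C} {L} {S} out≤I pairs admissible chains branchings compressed =
  +-cancelʳ-≤ U (4 * out) (3 * S) (begin
    4 * out + U                  ≤⟨ +-monoˡ-≤ U (*-monoʳ-≤ 4 out≤I) ⟩
    4 * I + U                    ≤⟨ +-monoʳ-≤ (4 * I) (≤-trans admissible (+-monoʳ-≤ (4 * P) chains)) ⟩
    4 * I + (4 * P + (L + B))    ≡⟨ factor I P L B ⟩
    4 * (I + P) + (L + B)        ≤⟨ +-monoˡ-≤ (L + B) (*-monoʳ-≤ 4 pairs) ⟩
    4 * (U + B) + (L + B)        ≡⟨ spread U B L ⟩
    (L + 4 * U + 3 * B) + 2 * B  ≤⟨ +-monoʳ-≤ (L + 4 * U + 3 * B) (*-monoʳ-≤ 2 B≤L) ⟩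
    (L + 4 * U + 3 * B) + 2 * L  ≡⟨ collect U B L ⟩
    3 * (L + (U + B)) + U        ≤⟨ +-monoˡ-≤ U (*-monoʳ-≤ 3 compressed) ⟩
    3 * S + U                    ∎)
  where
  open ≤-Reasoning
  B≤L : B ≤ L
  B≤L = ≤-trans (m≤m+n B 1) branchings
  factor : ∀ I P L B → 4 * I + (4 * P + (L + B)) ≡ 4 * (I + P) + (L + B)
  factor = solve-∀
  spread : ∀ U B L → 4 * (U + B) + (L + B) ≡ (L + 4 * U + 3 * B) + 2 * B
  spread = solve-∀
  collect : ∀ U B L → (L + 4 * U + 3 * B) + 2 * L ≡ 3 * (L + (U + B)) + U
  collect = solve-∀

phase-shrinks : ∀ {A : Set} (rank : A → ℕ) (_≟_ : DecidableEquality A) (T : Tree rank) → 1 < size T →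
                (up : Letter₁ rank _≟_ → Bool) → GoodPartition up (ChainCompression.chainCompress rank _≟_ T) →
                4 * phaseSize rank _≟_ T up ≤ 3 * size T
phase-shrinks rank _≟_ T big up good =
  phase-arithmetic leaf-step pair-step admissible maxChains-bound branch-bound chain-compression-step
  where
  open ChainCompression rank _≟_ using (rank₁; chainCompress)
  open PairCompression rank₁ up using (rank₂; pairCompress)
  open ChainCompressionSize rank _≟_ using (chainCompress-size; chainCompress-rootRank)
  open PairCompressionSize rank₁ up using (pc-inner; pc-rootRank)
  open LeafCompressionSize rank₂ using (leafCompress-size)

  T₁ : Tree rank₁
  T₁ = chainCompress T
  T₂ : Tree rank₂
  T₂ = pairCompress T₁

  inner-root₂ : 0 < rootRank T₂
  inner-root₂ = subst (0 <_) (sym (trans (pc-rootRank T₁) (chainCompress-rootRank T))) (big⇒inner-root T big)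

  leaf-step : size (LeafCompression.leafCompress rank₂ T₂) ≤ census innerᵂ T₂
  leaf-step = leafCompress-size T₂ inner-root₂

  pair-step : census innerᵂ T₂ + nUpDownPairs up T₁ ≤ census unaryᵂ T₁ + census branchᵂ T₁
  pair-step = ≤-trans (pc-inner T₁) (≤-reflexive (census-+ inner≡unary+branch T₁))

  admissible : census unaryᵂ T₁ ≤ 4 * nUpDownPairs up T₁ + nMaxChains T₁
  admissible = subst (_≤ 4 * nUpDownPairs up T₁ + nMaxChains T₁) (unaryNodes≡census T₁) good

  maxChains-bound : nMaxChains T₁ ≤ census leafᵂ T₁ + census branchᵂ T₁
  maxChains-bound = maxChains≤leaves+branchings T₁

  branch-bound : census branchᵂ T₁ + 1 ≤ census leafᵂ T₁
  branch-bound = branchings<leaves T₁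

  chain-compression-step : census leafᵂ T₁ + (census unaryᵂ T₁ + census branchᵂ T₁) ≤ size T
  chain-compression-step = subst (_≤ size T)
    (trans (size≡leaves+inner T₁) (cong (census leafᵂ T₁ +_) (census-+ inner≡unary+branch T₁)))
    (chainCompress-size T)

lemma3p8 : Σ ℕ λ p → Σ ℕ λ q → p < q ×
    ((A : Set) (rank : A → ℕ) (_≟_ : DecidableEquality A) (T : Tree rank) →
     1 < size T →
     (up : Letter₁ rank _≟_ → Bool) →
     GoodPartition up (ChainCompression.chainCompress rank _≟_ T) →
     q * phaseSize rank _≟_ T up ≤ p * size T)
lemma3p8 = 3 , 4 , ≤-refl , λ A → phase-shrinks
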